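{- Let $n\ge 2$ and let $a,b,d,m$ be positive integers with $b<a$ and $d<m$. Set $r=ma$, $s=db$ and $q=R(n;a,b)-1$. Then $R(n;r,s)>A_q(m,d)$.
   Context: For positive integers $n,r,s$ with $r>s$, an $(r,s)$-coloring of $K_N$ is a map $\chi:E(K_N)\to\binom{[r]}{s}$; a monochromatic $n$-clique is a set of $n$ vertices such that all edges among them share a common color. $R(n;r,s)$ is the minimum $N$ such that every $(r,s)$-coloring of $K_N$ contains a monochromatic $n$-clique. For positive integers $q,m,d$, $A_q(m,d)$ denotes the maximum size of a code $C\subseteq[q]^m$ in which any two distinct codewords differ in at least $d$ coordinates (Hamming distance at least $d$). -}

module Defs where

open import Data.Nat using (ℕ; zero; suc; _+_; _≤_)
open import Data.Fin using (Fin; _≟_)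
open import Data.Fin.Subset using (Subset; _∈_; ∣_∣)
open import Data.Vec using (Vec; []; _∷_)
open import Data.Product using (Σ; _×_)
open import Relation.Nullary using (¬_; yes; no)
open import Relation.Binary.PropositionalEquality using (_≡_; _≢_)
open import Function.Definitions using (Injective)

-- An (r,s)-colouring of K_N: a symmetric assignment to every pair of
-- distinct vertices of an s-element subset of [r] (= Fin r).
record Colouring (N r s : ℕ) : Set where
  field
    χ     : Fin N → Fin N → Subset r
    symm  : ∀ i j → χ i j ≡ χ j i
    size  : ∀ i j → i ≢ j → ∣ χ i j ∣ ≡ s

MonoClique : ∀ {N r s} → Colouring N r s → ℕ → Set
MonoClique {N} {r} col n =
  Σ (Fin n → Fin N) λ f → Injective _≡_ _≡_ f ×
    Σ (Fin r) λ c → ∀ i j → i ≢ j → c ∈ Colouring.χ col (f i) (f j)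

Arrows : ℕ → ℕ → ℕ → ℕ → Set
Arrows n r s N = (col : Colouring N r s) → MonoClique col n

hamming : ∀ {q m} → Vec (Fin q) m → Vec (Fin q) m → ℕ
hamming [] [] = 0
hamming (x ∷ xs) (y ∷ ys) with x ≟ y
... | yes _ = hamming xs ys
... | no  _ = suc (hamming xs ys)

HasCode : ℕ → ℕ → ℕ → ℕ → Set
HasCode q m d k =
  Σ (Fin k → Vec (Fin q) m) λ c → Injective _≡_ _≡_ c ×
    (∀ i j → i ≢ j → d ≤ hamming (c i) (c j))

IsLeast : (ℕ → Set) → ℕ → Set
IsLeast P N = P N × (∀ M → P M → N ≤ M)

IsMax : (ℕ → Set) → ℕ → Set
IsMax P N = P N × (∀ M → P M → M ≤ N)

{-# OPTIONS --safe #-}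

-- Take a code w₁, …, w_N in [q]^m of minimum distance d together with an
-- (a,b)-colouring χ of K_q, and split the r = ma colours into m blocks of a.
-- The edge {u,v} receives, in the block of coordinate i, the colour set
-- χ(w_u(i), w_v(i)) for the first d coordinates i at which w_u and w_v differ,
-- and nothing elsewhere: d·b colours in all. A monochromatic n-clique of colour
-- (i, c) makes the i-th letters of its codewords pairwise distinct and joined by
-- edges containing c, i.e. an n-clique of K_q monochromatic under χ. So if
-- every (ma, db)-colouring of K_N had one, so would every (a,b)-colouring of
-- K_q with q = R(n;a,b) − 1, contradicting the minimality of R(n;a,b).
module Submission where

open import Defs
open import Data.Nat using (ℕ; zero; suc; _+_; _*_; _∸_; _≤_; _<_; z≤n; s≤s; z<s; s≤s⁻¹)
open import Data.Nat.Properties using (≰⇒>; ≤-trans; <-≤-trans; <-irrefl; ∸-monoʳ-<)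
open import Data.Fin using (Fin; zero; suc; _≟_; inject≤; combine; quotient; remainder)
open import Data.Fin.Properties using (inject≤-injective; combine-remQuot)
open import Data.Fin.Subset using (Subset; _∈_; ∣_∣; ⊥; inside)
open import Data.Fin.Subset.Properties using (∉⊥; ∣⊥∣≡0)
open import Data.Bool using (true; false)
open import Data.Vec using (Vec; []; _∷_; _++_; concat; lookup; map; sum)
open import Data.Vec.Properties using (lookup-concat; []=⇒lookup; lookup⇒[]=)
open import Data.Product using (_×_; _,_; proj₁; proj₂)
open import Relation.Nullary using (yes; no; contradiction)
open import Relation.Binary.PropositionalEquality
  using (_≡_; _≢_; refl; sym; trans; cong; cong₂; module ≡-Reasoning)

∣p++q∣ : ∀ {k l} (p : Subset k) (q : Subset l) → ∣ p ++ q ∣ ≡ ∣ p ∣ + ∣ q ∣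
∣p++q∣ []          q = refl
∣p++q∣ (true  ∷ p) q = cong suc (∣p++q∣ p q)
∣p++q∣ (false ∷ p) q = ∣p++q∣ p q

∣concat∣ : ∀ {m a} (ps : Vec (Subset a) m) → ∣ concat ps ∣ ≡ sum (map ∣_∣ ps)
∣concat∣ []       = refl
∣concat∣ (p ∷ ps) = trans (∣p++q∣ p (concat ps)) (cong (∣ p ∣ +_) (∣concat∣ ps))

∈-concat⁻ : ∀ {m a} (ps : Vec (Subset a) m) {x : Fin (m * a)} →
            x ∈ concat ps → remainder {m} a x ∈ lookup ps (quotient {m} a x)
∈-concat⁻ {m} {a} ps {x} x∈ps = lookup⇒[]= j (lookup ps i) (begin
  lookup (lookup ps i) j           ≡⟨ lookup-concat ps i j ⟨
  lookup (concat ps) (combine i j) ≡⟨ cong (lookup (concat ps)) (combine-remQuot {m} a x) ⟩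
  lookup (concat ps) x             ≡⟨ []=⇒lookup x∈ps ⟩
  inside                           ∎)
  where
  open ≡-Reasoning
  i = quotient {m} a x
  j = remainder {m} a x

shrinkCode : ∀ {q m d N A} → N ≤ A → HasCode q m d A → HasCode q m d N
shrinkCode N≤A (w , w-inj , w-dist) =
  (λ i → w (inject≤ i N≤A)) ,
  (λ eq → inject≤-injective N≤A N≤A _ _ (w-inj eq)) ,
  (λ i j i≢j → w-dist _ _ (λ eq → i≢j (inject≤-injective N≤A N≤A i j eq)))

emptyColouring : ∀ {r s} → Colouring 0 r s
emptyColouring = record { χ = λ () ; symm = λ () ; size = λ () }

arrows⇒0< : ∀ {n r s N} → 0 < n → Arrows n r s N → 0 < N
arrows⇒0< {N = zero}  (s≤s _) arrows with proj₁ (arrows emptyColouring) zero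
... | ()
arrows⇒0< {N = suc _} _       _      = z<s

module CodeColouring {q a b} (col : Colouring q a b) where
  open Colouring col

  -- k is the number of differing coordinates that may still be coloured.
  blocks : ∀ {m} → ℕ → Vec (Fin q) m → Vec (Fin q) m → Vec (Subset a) m
  blocks _       []       []       = []
  blocks zero    (_ ∷ xs) (_ ∷ ys) = ⊥ ∷ blocks zero xs ys
  blocks (suc k) (x ∷ xs) (y ∷ ys) with x ≟ y
  ... | yes _ = ⊥ ∷ blocks (suc k) xs ys
  ... | no  _ = χ x y ∷ blocks k xs ys

  blocks-comm : ∀ {m} k (xs ys : Vec (Fin q) m) → blocks k xs ys ≡ blocks k ys xs
  blocks-comm _       []       []       = refl
  blocks-comm zero    (_ ∷ xs) (_ ∷ ys) = cong (⊥ ∷_) (blocks-comm zero xs ys)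
  blocks-comm (suc k) (x ∷ xs) (y ∷ ys) with x ≟ y | y ≟ x
  ... | yes _   | yes _   = cong (⊥ ∷_) (blocks-comm (suc k) xs ys)
  ... | yes x≡y | no  y≢x = contradiction (sym x≡y) y≢x
  ... | no  x≢y | yes y≡x = contradiction (sym y≡x) x≢y
  ... | no  _   | no  _   = cong₂ _∷_ (symm x y) (blocks-comm k xs ys)

  ∣blocks∣ : ∀ {m} k (xs ys : Vec (Fin q) m) → k ≤ hamming xs ys →
             sum (map ∣_∣ (blocks k xs ys)) ≡ k * b
  ∣blocks∣ zero    []       []       _ = refl
  ∣blocks∣ zero    (_ ∷ xs) (_ ∷ ys) _ = cong₂ _+_ (∣⊥∣≡0 a) (∣blocks∣ zero xs ys z≤n)
  ∣blocks∣ (suc k) []       []       ()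
  ∣blocks∣ (suc k) (x ∷ xs) (y ∷ ys) k≤dist with x ≟ y
  ... | yes _   = cong₂ _+_ (∣⊥∣≡0 a) (∣blocks∣ (suc k) xs ys k≤dist)
  ... | no  x≢y = cong₂ _+_ (size x y x≢y) (∣blocks∣ k xs ys (s≤s⁻¹ k≤dist))

  ∈-blocks⁻ : ∀ {m} k (xs ys : Vec (Fin q) m) i {c} → c ∈ lookup (blocks k xs ys) i →
              lookup xs i ≢ lookup ys i × c ∈ χ (lookup xs i) (lookup ys i)
  ∈-blocks⁻ zero    (_ ∷ _)  (_ ∷ _)  zero    c∈ = contradiction c∈ ∉⊥
  ∈-blocks⁻ zero    (_ ∷ xs) (_ ∷ ys) (suc i) c∈ = ∈-blocks⁻ zero xs ys i c∈
  ∈-blocks⁻ (suc k) (x ∷ xs) (y ∷ ys) i       c∈ with x ≟ y | i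
  ... | yes _   | zero  = contradiction c∈ ∉⊥
  ... | yes _   | suc i = ∈-blocks⁻ (suc k) xs ys i c∈
  ... | no  x≢y | zero  = x≢y , c∈
  ... | no  _   | suc i = ∈-blocks⁻ k xs ys i c∈

  module _ {N m d} (w : Fin N → Vec (Fin q) m)
           (w-dist : ∀ i j → i ≢ j → d ≤ hamming (w i) (w j)) where

    codeColouring : Colouring N (m * a) (d * b)
    codeColouring = record
      { χ    = λ u v → concat (blocks d (w u) (w v))
      ; symm = λ u v → cong concat (blocks-comm d (w u) (w v))
      ; size = λ u v u≢v → trans (∣concat∣ (blocks d (w u) (w v)))
                                 (∣blocks∣ d (w u) (w v) (w-dist u v u≢v))
      }

    projectClique : ∀ {n} → MonoClique codeColouring n → MonoClique col n
    projectClique {n} (f , _ , c , mono) = g , g-injective , colour , g-mono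
      where
      i      = quotient {m} a c
      colour = remainder {m} a c

      g : Fin n → Fin q
      g j = lookup (w (f j)) i

      edge : ∀ j k → j ≢ k → g j ≢ g k × colour ∈ χ (g j) (g k)
      edge j k j≢k = ∈-blocks⁻ d (w (f j)) (w (f k)) i
                                (∈-concat⁻ (blocks d (w (f j)) (w (f k))) (mono j k j≢k))

      g-injective : ∀ {j k} → g j ≡ g k → j ≡ k
      g-injective {j} {k} gj≡gk with j ≟ k
      ... | yes j≡k = j≡k
      ... | no  j≢k = contradiction gj≡gk (proj₁ (edge j k j≢k))

      g-mono : ∀ j k → j ≢ k → colour ∈ χ (g j) (g k)
      g-mono j k j≢k = proj₂ (edge j k j≢k)

arrows-fromCode : ∀ {n a b q m d N} → HasCode q m d N →
                  Arrows n (m * a) (d * b) N → Arrows n a b q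
arrows-fromCode (w , _ , w-dist) arrows col =
  projectClique w w-dist (arrows (codeColouring w w-dist))
  where open CodeColouring col

theorem2p1 : ∀ (n a b d m : ℕ) → 2 ≤ n → 1 ≤ a → 1 ≤ b → b < a → 1 ≤ d → 1 ≤ m → d < m →
    ∀ (Rab : ℕ) → IsLeast (Arrows n a b) Rab →
    ∀ (A : ℕ) → IsMax (HasCode (Rab ∸ 1) m d) A →
    ∀ (Rrs : ℕ) → IsLeast (Arrows n (m * a) (d * b)) Rrs →
    A < Rrs
theorem2p1 n a b d m 2≤n _ _ _ _ _ _ Rab (arrows-Rab , least-Rab) A (code-A , _)
           Rrs (arrows-Rrs , _) = ≰⇒> λ Rrs≤A →
  let arrows-q = arrows-fromCode (shrinkCode Rrs≤A code-A) arrows-Rrs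
      0<Rab    = arrows⇒0< (≤-trans (s≤s z≤n) 2≤n) arrows-Rab
  in <-irrefl refl (<-≤-trans (∸-monoʳ-< z<s 0<Rab) (least-Rab (Rab ∸ 1) arrows-q))
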